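{- Let $P:\mathcal{C}^{op}\to\mathbf{InfSL}$ be an elementary doctrine with weak comprehensions. Then in the doctrine $\overline{P}:\mathcal{Q}_P^{op}\to\mathbf{InfSL}$ every $\overline{P}$-equivalence relation has an effective quotient, and these quotients are of effective descent.
   Context: A primary doctrine is a functor $P:\mathcal{C}^{op}\to\mathbf{InfSL}$ where $\mathcal{C}$ has finite products, each $P(A)$ is a poset with finite meets ($\wedge$, top $\top_A$) and each $P_f$ preserves them. Write $f\times g=\langle f\circ pr_1,g\circ pr_2\rangle$, $\Delta_A=\langle id_A,id_A\rangle$. $P$ is elementary if each $P_{id_C\times\Delta_A}$ has a left adjoint $\exists_{id_C\times\Delta_A}$ satisfying Frobenius reciprocity; $\delta_A=\exists_{\Delta_A}(\top_A)$. A weak comprehension of $\alpha\in P(A)$ is $\{\alpha\}:X\to A$ with $\top_X\le P_{\{\alpha\}}(\alpha)$ through which every $g:Y\to A$ with $\top_Y\le P_g(\alpha)$ factors (not necessarily uniquely). For any elementary doctrine $R:\mathcal{D}^{op}\to\mathbf{InfSL}$: an $R$-equivalence relation on $A$ is $\rho\in R(A\times A)$ with $\delta_A\le\rho$, $\rho\le R_{\langle pr_2,pr_1\rangle}(\rho)$, $R_{\langle pr_1,pr_2\rangle}(\rho)\wedge R_{\langle pr_2,pr_3\rangle}(\rho)\le R_{\langle pr_1,pr_3\rangle}(\rho)$; a quotient of $\rho$ is $q:A\to C$ with $\rho\le R_{q\times q}(\delta_C)$ such that every $g:A\to Z$ with $\rho\le R_{g\times g}(\delta_Z)$ factors uniquely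 through $q$; it is effective if $R_{q\times q}(\delta_C)=\rho$; $\mathrm{des}(\rho)=\{\alpha\in R(A):R_{pr_1}(\alpha)\wedge\rho\le R_{pr_2}(\alpha)\}$; $f:A\to B$ is of effective descent if $R_f:R(B)\to\mathrm{des}(R_{f\times f}(\delta_B))$ is an isomorphism. Elementary quotient completion: $\mathcal{Q}_P$ has objects $(A,\rho)$ with $\rho$ a $P$-equivalence relation on $A$; arrows $(A,\rho)\to(B,\sigma)$ are classes $[f]$ of $f:A\to B$ with $\rho\le P_{f\times f}(\sigma)$ modulo $f\sim g$ iff $\rho\le P_{f\times g}(\sigma)$. $\overline{P}(A,\rho)=\mathrm{des}(\rho)$ (computed in $P$), $\overline{P}_{[f]}=P_f$. Under the hypotheses $\overline{P}$ is an elementary doctrine. -}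

module Defs where

open import Level using (Level; _⊔_) renaming (suc to lsuc)
open import Data.Product using (Σ; _×_; _,_; proj₁; proj₂)

record CartOps (o m e : Level) : Set (lsuc (o ⊔ m ⊔ e)) where
  infixr 9 _∘_
  infixr 7 _⊗_ _⊗₁_
  infix  4 _≈_
  field
    Obj   : Set o
    Hom   : Obj → Obj → Set m
    _≈_   : ∀ {A B} → Hom A B → Hom A B → Set e
    id    : ∀ {A} → Hom A A
    _∘_   : ∀ {A B D} → Hom B D → Hom A B → Hom A D
    𝟙     : Obj
    !     : ∀ {A} → Hom A 𝟙
    _⊗_   : Obj → Obj → Obj
    π₁    : ∀ {A B} → Hom (A ⊗ B) A
    π₂    : ∀ {A B} → Hom (A ⊗ B) B
    ⟨_,_⟩ : ∀ {X A B} → Hom X A → Hom X B → Hom X (A ⊗ B)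

  _⊗₁_ : ∀ {A B A' B'} → Hom A B → Hom A' B' → Hom (A ⊗ A') (B ⊗ B')
  f ⊗₁ g = ⟨ f ∘ π₁ , g ∘ π₂ ⟩

  Δ : ∀ {A} → Hom A (A ⊗ A)
  Δ = ⟨ id , id ⟩

  swap : ∀ {A} → Hom (A ⊗ A) (A ⊗ A)
  swap = ⟨ π₂ , π₁ ⟩

  p₁ p₂ p₃ : ∀ {A} → Hom ((A ⊗ A) ⊗ A) A
  p₁ = π₁ ∘ π₁
  p₂ = π₂ ∘ π₁
  p₃ = π₂

record IsCartesian {o m e} (C : CartOps o m e) : Set (o ⊔ m ⊔ e) where
  open CartOps C
  field
    ≈-refl   : ∀ {A B} {f : Hom A B} → f ≈ f
    ≈-sym    : ∀ {A B} {f g : Hom A B} → f ≈ g → g ≈ f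
    ≈-trans  : ∀ {A B} {f g h : Hom A B} → f ≈ g → g ≈ h → f ≈ h
    ∘-resp   : ∀ {A B D} {f f' : Hom B D} {g g' : Hom A B} →
               f ≈ f' → g ≈ g' → f ∘ g ≈ f' ∘ g'
    idˡ      : ∀ {A B} {f : Hom A B} → id ∘ f ≈ f
    idʳ      : ∀ {A B} {f : Hom A B} → f ∘ id ≈ f
    assoc    : ∀ {A B D E} {f : Hom A B} {g : Hom B D} {h : Hom D E} →
               (h ∘ g) ∘ f ≈ h ∘ (g ∘ f)
    !-unique : ∀ {A} (f : Hom A 𝟙) → f ≈ !
    π₁-β     : ∀ {X A B} {f : Hom X A} {g : Hom X B} → π₁ ∘ ⟨ f , g ⟩ ≈ f
    π₂-β     : ∀ {X A B} {f : Hom X A} {g : Hom X B} → π₂ ∘ ⟨ f , g ⟩ ≈ g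
    ⟨⟩-unique : ∀ {X A B} {f : Hom X A} {g : Hom X B} {h : Hom X (A ⊗ B)} →
                π₁ ∘ h ≈ f → π₂ ∘ h ≈ g → h ≈ ⟨ f , g ⟩

record DocOps {o m e} (C : CartOps o m e) (p l : Level) : Set (o ⊔ m ⊔ lsuc (p ⊔ l)) where
  open CartOps C
  infix  4 _≤_ _≃_
  infixr 6 _∧_
  field
    Pred    : Obj → Set p
    _≤_     : ∀ {A} → Pred A → Pred A → Set l
    ⊤       : ∀ {A} → Pred A
    _∧_     : ∀ {A} → Pred A → Pred A → Pred A
    reindex : ∀ {A B} → Hom A B → Pred B → Pred A

  _≃_ : ∀ {A} → Pred A → Pred A → Set l
  α ≃ β = (α ≤ β) × (β ≤ α)

record IsPrimary {o m e p l} (C : CartOps o m e) (P : DocOps C p l) : Set (o ⊔ m ⊔ e ⊔ p ⊔ l) where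
  open CartOps C
  open DocOps P
  field
    ≤-refl   : ∀ {A} {α : Pred A} → α ≤ α
    ≤-trans  : ∀ {A} {α β γ : Pred A} → α ≤ β → β ≤ γ → α ≤ γ
    ⊤-max    : ∀ {A} {α : Pred A} → α ≤ ⊤
    ∧-lb₁    : ∀ {A} {α β : Pred A} → α ∧ β ≤ α
    ∧-lb₂    : ∀ {A} {α β : Pred A} → α ∧ β ≤ β
    ∧-glb    : ∀ {A} {α β γ : Pred A} → γ ≤ α → γ ≤ β → γ ≤ α ∧ β
    re-mono  : ∀ {A B} (f : Hom A B) {α β : Pred B} → α ≤ β → reindex f α ≤ reindex f β
    re-⊤     : ∀ {A B} (f : Hom A B) → reindex f ⊤ ≃ ⊤
    re-∧     : ∀ {A B} (f : Hom A B) {α β : Pred B} →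
               reindex f (α ∧ β) ≃ reindex f α ∧ reindex f β
    re-resp  : ∀ {A B} {f g : Hom A B} {α : Pred B} → f ≈ g → reindex f α ≃ reindex g α
    re-id    : ∀ {A} {α : Pred A} → reindex id α ≃ α
    re-∘     : ∀ {A B D} {f : Hom A B} {g : Hom B D} {α : Pred D} →
               reindex (g ∘ f) α ≃ reindex f (reindex g α)

module Notions {o m e p l} (D : CartOps o m e) (R : DocOps D p l) where
  open CartOps D
  open DocOps R

  -- elementary structure: left adjoints ∃_{id_C × Δ_A} ⊣ R_{id_C × Δ_A}
  -- with Frobenius reciprocity, and ∃_{Δ_A} ⊣ R_{Δ_A} (used for δ_A).
  record Elementary : Set (o ⊔ m ⊔ p ⊔ l) where
    field
      ∃Δ       : ∀ {A} → Pred A → Pred (A ⊗ A)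
      ∃Δ-unit  : ∀ {A} {α : Pred A} {β : Pred (A ⊗ A)} → ∃Δ α ≤ β → α ≤ reindex Δ β
      ∃Δ-counit : ∀ {A} {α : Pred A} {β : Pred (A ⊗ A)} → α ≤ reindex Δ β → ∃Δ α ≤ β
      ∃ₑ       : ∀ {X A} → Pred (X ⊗ A) → Pred (X ⊗ (A ⊗ A))
      ∃ₑ-unit  : ∀ {X A} {α : Pred (X ⊗ A)} {β : Pred (X ⊗ (A ⊗ A))} →
                 ∃ₑ α ≤ β → α ≤ reindex (id ⊗₁ Δ) β
      ∃ₑ-counit : ∀ {X A} {α : Pred (X ⊗ A)} {β : Pred (X ⊗ (A ⊗ A))} →
                 α ≤ reindex (id ⊗₁ Δ) β → ∃ₑ α ≤ β
      frobenius : ∀ {X A} {α : Pred (X ⊗ A)} {β : Pred (X ⊗ (A ⊗ A))} →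
                 ∃ₑ (α ∧ reindex (id ⊗₁ Δ) β) ≃ (∃ₑ α ∧ β)

  Des : ∀ {A} → Pred (A ⊗ A) → Pred A → Set l
  Des ρ α = (reindex π₁ α ∧ ρ) ≤ reindex π₂ α

  WeakComprehension : ∀ {A} → Pred A → Set (o ⊔ m ⊔ e ⊔ l)
  WeakComprehension {A} α =
    Σ Obj λ X → Σ (Hom X A) λ c →
      (⊤ ≤ reindex c α) ×
      (∀ {Y} (g : Hom Y A) → ⊤ ≤ reindex g α → Σ (Hom Y X) λ h → c ∘ h ≈ g)

  module WithElementary (E : Elementary) where
    open Elementary E

    δ : ∀ A → Pred (A ⊗ A)
    δ A = ∃Δ (⊤ {A})

    record IsEqRel {A} (ρ : Pred (A ⊗ A)) : Set l where
      field
        reflexive  : δ A ≤ ρ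
        symmetric  : ρ ≤ reindex swap ρ
        transitive : reindex ⟨ p₁ , p₂ ⟩ ρ ∧ reindex ⟨ p₂ , p₃ ⟩ ρ ≤ reindex ⟨ p₁ , p₃ ⟩ ρ

    IsQuotient : ∀ {A Q} → Pred (A ⊗ A) → Hom A Q → Set (o ⊔ m ⊔ e ⊔ l)
    IsQuotient {A} {Q} ρ q =
      (ρ ≤ reindex (q ⊗₁ q) (δ Q)) ×
      (∀ {Z} (g : Hom A Z) → ρ ≤ reindex (g ⊗₁ g) (δ Z) →
         Σ (Hom Q Z) λ h → (h ∘ q ≈ g) × (∀ (h' : Hom Q Z) → h' ∘ q ≈ g → h' ≈ h))

    IsEffective : ∀ {A Q} → Pred (A ⊗ A) → Hom A Q → Set l
    IsEffective {A} {Q} ρ q = reindex (q ⊗₁ q) (δ Q) ≃ ρ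

    -- f : A → B is of effective descent: R_f : R(B) → des(R_{f×f}(δ_B))
    -- is (well defined and) an isomorphism of posets.
    record IsEffectiveDescent {A B} (f : Hom A B) : Set (p ⊔ l) where
      κ : Pred (A ⊗ A)
      κ = reindex (f ⊗₁ f) (δ B)
      field
        into     : ∀ (α : Pred B) → Des κ (reindex f α)
        inv      : ∀ (β : Pred A) → Des κ β → Pred B
        inv-mono : ∀ {β β'} (d : Des κ β) (d' : Des κ β') → β ≤ β' → inv β d ≤ inv β' d'
        inv-left : ∀ (α : Pred B) → inv (reindex f α) (into α) ≃ α
        inv-right : ∀ (β : Pred A) (d : Des κ β) → reindex f (inv β d) ≃ β

module Completion {o m e p l}
  (C : CartOps o m e) (isC : IsCartesian C)
  (P : DocOps C p l) (isP : IsPrimary C P)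
  (E : Notions.Elementary C P) where

  open CartOps C
  open IsCartesian isC
  open DocOps P
  open IsPrimary isP
  open Notions C P
  open WithElementary E
  open Elementary E

  infixr 2 _■_
  _■_ : ∀ {A B} {f g h : Hom A B} → f ≈ g → g ≈ h → f ≈ h
  _■_ = ≈-trans

  ⟨⟩-cong : ∀ {X A B} {f f' : Hom X A} {g g' : Hom X B} → f ≈ f' → g ≈ g' → ⟨ f , g ⟩ ≈ ⟨ f' , g' ⟩
  ⟨⟩-cong a b = ⟨⟩-unique (π₁-β ■ a) (π₂-β ■ b)

  ⟨⟩∘ : ∀ {Y X A B} {f : Hom X A} {g : Hom X B} {h : Hom Y X} → ⟨ f , g ⟩ ∘ h ≈ ⟨ f ∘ h , g ∘ h ⟩
  ⟨⟩∘ = ⟨⟩-unique (≈-sym assoc ■ ∘-resp π₁-β ≈-refl) (≈-sym assoc ■ ∘-resp π₂-β ≈-refl)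

  ⊗∘⟨⟩ : ∀ {X A B A' B'} {f : Hom A B} {g : Hom A' B'} {h : Hom X A} {k : Hom X A'} →
         (f ⊗₁ g) ∘ ⟨ h , k ⟩ ≈ ⟨ f ∘ h , g ∘ k ⟩
  ⊗∘⟨⟩ = ⟨⟩∘ ■ ⟨⟩-cong (assoc ■ ∘-resp ≈-refl π₁-β) (assoc ■ ∘-resp ≈-refl π₂-β)

  ⊗∘⊗ : ∀ {A B D A' B' D'} {f : Hom A B} {g : Hom B D} {f' : Hom A' B'} {g' : Hom B' D'} →
        (g ⊗₁ g') ∘ (f ⊗₁ f') ≈ (g ∘ f) ⊗₁ (g' ∘ f')
  ⊗∘⊗ = ⊗∘⟨⟩ ■ ⟨⟩-cong (≈-sym assoc) (≈-sym assoc)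

  ⊗-cong : ∀ {A B A' B'} {f g : Hom A B} {f' g' : Hom A' B'} → f ≈ g → f' ≈ g' → f ⊗₁ f' ≈ g ⊗₁ g'
  ⊗-cong a b = ⟨⟩-cong (∘-resp a ≈-refl) (∘-resp b ≈-refl)

  id⊗id : ∀ {A B} → id {A ⊗ B} ≈ id ⊗₁ id
  id⊗id = ⟨⟩-unique (idʳ ■ ≈-sym idˡ) (idʳ ■ ≈-sym idˡ)

  swap-nat : ∀ {A B} {f : Hom A B} → swap ∘ (f ⊗₁ f) ≈ (f ⊗₁ f) ∘ swap
  swap-nat = ⟨⟩∘ ■ ⟨⟩-cong π₂-β π₁-β ■ ≈-sym ⊗∘⟨⟩

  Δ-nat : ∀ {A B} {f : Hom A B} → Δ ∘ f ≈ (f ⊗₁ f) ∘ Δ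
  Δ-nat = ⟨⟩∘ ■ ⟨⟩-cong (idˡ ■ ≈-sym idʳ) (idˡ ■ ≈-sym idʳ) ■ ≈-sym ⊗∘⟨⟩

  t : ∀ {A B} → Hom A B → Hom ((A ⊗ A) ⊗ A) ((B ⊗ B) ⊗ B)
  t f = (f ⊗₁ f) ⊗₁ f

  p₁-nat : ∀ {A B} {f : Hom A B} → p₁ ∘ t f ≈ f ∘ p₁
  p₁-nat = assoc ■ ∘-resp ≈-refl π₁-β ■ ≈-sym assoc ■ ∘-resp π₁-β ≈-refl ■ assoc
  p₂-nat : ∀ {A B} {f : Hom A B} → p₂ ∘ t f ≈ f ∘ p₂
  p₂-nat = assoc ■ ∘-resp ≈-refl π₁-β ■ ≈-sym assoc ■ ∘-resp π₂-β ≈-refl ■ assoc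
  p₃-nat : ∀ {A B} {f : Hom A B} → p₃ ∘ t f ≈ f ∘ p₃
  p₃-nat = π₂-β

  pair-nat : ∀ {A B} {f : Hom A B} {a b : ∀ {X} → Hom ((X ⊗ X) ⊗ X) X} →
             a ∘ t f ≈ f ∘ a → b ∘ t f ≈ f ∘ b →
             ⟨ a , b ⟩ ∘ t f ≈ (f ⊗₁ f) ∘ ⟨ a , b ⟩
  pair-nat x y = ⟨⟩∘ ■ ⟨⟩-cong x y ■ ≈-sym ⊗∘⟨⟩

  infixr 2 _▸_
  _▸_ : ∀ {A} {α β γ : Pred A} → α ≤ β → β ≤ γ → α ≤ γ
  _▸_ = ≤-trans

  mv : ∀ {A B B' D} {a : Hom B D} {b : Hom A B} {c : Hom B' D} {d : Hom A B'} {α : Pred D} →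
       a ∘ b ≈ c ∘ d → reindex b (reindex a α) ≤ reindex d (reindex c α)
  mv eq = proj₂ re-∘ ▸ proj₁ (re-resp eq) ▸ proj₁ re-∘

  record QObj : Set (o ⊔ p ⊔ l) where
    constructor qobj
    field
      car : Obj
      rel : Pred (car ⊗ car)
      isEq : IsEqRel rel
  open QObj public

  record QHom (X Y : QObj) : Set (m ⊔ l) where
    constructor qhom
    field
      fun  : Hom (car X) (car Y)
      pres : rel X ≤ reindex (fun ⊗₁ fun) (rel Y)
  open QHom public

  _⊠_ : ∀ {A B} → Pred (A ⊗ A) → Pred (B ⊗ B) → Pred ((A ⊗ B) ⊗ (A ⊗ B))
  ρ ⊠ σ = reindex (π₁ ⊗₁ π₁) ρ ∧ reindex (π₂ ⊗₁ π₂) σ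

  ⊠-eq : ∀ {A B} (ρ : Pred (A ⊗ A)) (σ : Pred (B ⊗ B)) → IsEqRel ρ → IsEqRel σ → IsEqRel (ρ ⊠ σ)
  ⊠-eq {A} {B} ρ σ r s = record
    { reflexive = ∧-glb (dpart π₁ (IsEqRel.reflexive r)) (dpart π₂ (IsEqRel.reflexive s))
    ; symmetric = ∧-glb (∧-lb₁ ▸ spart π₁ (IsEqRel.symmetric r)) (∧-lb₂ ▸ spart π₂ (IsEqRel.symmetric s))
                  ▸ proj₂ (re-∧ swap)
    ; transitive = ∧-glb (tpart π₁ ∧-lb₁ (IsEqRel.transitive r)) (tpart π₂ ∧-lb₂ (IsEqRel.transitive s))
                   ▸ proj₂ (re-∧ ⟨ p₁ , p₃ ⟩)
    }
    where
    dpart : ∀ {X} (π : Hom (A ⊗ B) X) {τ : Pred (X ⊗ X)} → δ X ≤ τ → δ (A ⊗ B) ≤ reindex (π ⊗₁ π) τ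
    dpart π {τ} h = ∃Δ-counit (proj₂ (re-⊤ π) ▸ re-mono π (∃Δ-unit h) ▸ mv Δ-nat)
    spart : ∀ {X} (π : Hom (A ⊗ B) X) {τ : Pred (X ⊗ X)} → τ ≤ reindex swap τ →
            reindex (π ⊗₁ π) τ ≤ reindex swap (reindex (π ⊗₁ π) τ)
    spart π h = re-mono (π ⊗₁ π) h ▸ mv swap-nat
    tpart : ∀ {X} (π : Hom (A ⊗ B) X) {τ : Pred (X ⊗ X)} →
            ρ ⊠ σ ≤ reindex (π ⊗₁ π) τ →
            reindex ⟨ p₁ , p₂ ⟩ τ ∧ reindex ⟨ p₂ , p₃ ⟩ τ ≤ reindex ⟨ p₁ , p₃ ⟩ τ →
            reindex ⟨ p₁ , p₂ ⟩ (ρ ⊠ σ) ∧ reindex ⟨ p₂ , p₃ ⟩ (ρ ⊠ σ) ≤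
            reindex ⟨ p₁ , p₃ ⟩ (reindex (π ⊗₁ π) τ)
    tpart π sel tr =
      ∧-glb (∧-lb₁ ▸ re-mono ⟨ p₁ , p₂ ⟩ sel ▸ mv (≈-sym (pair-nat {a = p₁} {b = p₂} p₁-nat p₂-nat)))
            (∧-lb₂ ▸ re-mono ⟨ p₂ , p₃ ⟩ sel ▸ mv (≈-sym (pair-nat {a = p₂} {b = p₃} p₂-nat p₃-nat)))
      ▸ proj₂ (re-∧ (t π)) ▸ re-mono (t π) tr
      ▸ mv (pair-nat {a = p₁} {b = p₃} p₁-nat p₃-nat)

  QEq : ∀ {X Y} → QHom X Y → QHom X Y → Set l
  QEq {X} {Y} f g = rel X ≤ reindex (fun f ⊗₁ fun g) (rel Y)

  Q : CartOps (o ⊔ p ⊔ l) (m ⊔ l) l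
  Q = record
    { Obj = QObj
    ; Hom = QHom
    ; _≈_ = QEq
    ; id = λ {X} → qhom id (proj₂ re-id ▸ proj₁ (re-resp id⊗id))
    ; _∘_ = λ g f → qhom (fun g ∘ fun f)
              (pres f ▸ re-mono (fun f ⊗₁ fun f) (pres g) ▸ proj₂ re-∘ ▸ proj₁ (re-resp ⊗∘⊗))
    ; 𝟙 = qobj 𝟙 ⊤ (record { reflexive = ⊤-max ; symmetric = proj₂ (re-⊤ swap)
                          ; transitive = ⊤-max ▸ proj₂ (re-⊤ ⟨ p₁ , p₃ ⟩) })
    ; ! = qhom ! (⊤-max ▸ proj₂ (re-⊤ (! ⊗₁ !)))
    ; _⊗_ = λ X Y → qobj (car X ⊗ car Y) (rel X ⊠ rel Y) (⊠-eq (rel X) (rel Y) (isEq X) (isEq Y))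
    ; π₁ = qhom π₁ ∧-lb₁
    ; π₂ = qhom π₂ ∧-lb₂
    ; ⟨_,_⟩ = λ f g → qhom ⟨ fun f , fun g ⟩
              (∧-glb (pres f ▸ proj₂ (re-resp (⊗∘⊗ ■ ⊗-cong π₁-β π₁-β)) ▸ proj₁ re-∘)
                     (pres g ▸ proj₂ (re-resp (⊗∘⊗ ■ ⊗-cong π₂-β π₂-β)) ▸ proj₁ re-∘)
               ▸ proj₂ (re-∧ _))
    }

  P̄ : DocOps Q (p ⊔ l) l
  P̄ = record
    { Pred = λ X → Σ (Pred (car X)) λ α → Des (rel X) α
    ; _≤_ = λ α β → proj₁ α ≤ proj₁ β
    ; ⊤ = ⊤ , (⊤-max ▸ proj₂ (re-⊤ π₂))
    ; _∧_ = λ α β → (proj₁ α ∧ proj₁ β) ,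
              (∧-glb (∧-glb (∧-lb₁ ▸ re-mono π₁ ∧-lb₁) ∧-lb₂ ▸ proj₂ α)
                    (∧-glb (∧-lb₁ ▸ re-mono π₁ ∧-lb₂) ∧-lb₂ ▸ proj₂ β)
              ▸ proj₂ (re-∧ π₂))
    ; reindex = λ f α → reindex (fun f) (proj₁ α) ,
              (∧-glb (∧-lb₁ ▸ mv (≈-sym π₁-β)) (∧-lb₂ ▸ pres f)
              ▸ proj₂ (re-∧ _) ▸ re-mono _ (proj₂ α) ▸ mv π₂-β)
    }

-- In P̄ the diagonal of an object (A, r) is r itself, up to ≃: δ̄ ≤ r because r is a
-- descent datum for its own square r ⊠ r and ⊤ ≤ Δ*r, and r ≤ δ̄ because δ̄ holds at
-- (a, a) and descends along r((a, a), (a, b)). Hence a P̄-equivalence relation ρ on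
-- (A, r) is just a P-equivalence relation containing r, its quotient is
-- [id] : (A, r) → (A, ρ), effectivity is δ̄(A, ρ) ≃ ρ, and effective descent holds
-- because P̄(A, ρ) is des(ρ) by definition.

module Submission where

open import Level using (Level)
open import Data.Product using (Σ; _×_; _,_; proj₁; proj₂)
open import Defs

module Relations {o m e p l : Level}
    (C : CartOps o m e) (isC : IsCartesian C)
    (P : DocOps C p l) (isP : IsPrimary C P)
    (E : Notions.Elementary C P) where
  open CartOps C
  open IsCartesian isC
  open DocOps P
  open IsPrimary isP
  open Notions C P
  open WithElementary E
  open Elementary E
  open Completion C isC P isP E

  reindex-∘≈ : ∀ {A B D} {f : Hom A B} {g : Hom B D} {h : Hom A D} {α : Pred D} →
               g ∘ f ≈ h → reindex f (reindex g α) ≃ reindex h α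
  reindex-∘≈ g∘f≈h = (proj₂ re-∘ ▸ proj₁ (re-resp g∘f≈h)) , (proj₂ (re-resp g∘f≈h) ▸ proj₁ re-∘)

  infix 10 _⟦_,_⟧
  _⟦_,_⟧ : ∀ {A Y} → Pred (A ⊗ A) → Hom Y A → Hom Y A → Pred Y
  ρ ⟦ f , g ⟧ = reindex ⟨ f , g ⟩ ρ

  ⟦⟧-cong : ∀ {A Y} {ρ : Pred (A ⊗ A)} {f f' g g' : Hom Y A} →
            f ≈ f' → g ≈ g' → ρ ⟦ f , g ⟧ ≤ ρ ⟦ f' , g' ⟧
  ⟦⟧-cong f≈f' g≈g' = proj₁ (re-resp (⟨⟩-cong f≈f' g≈g'))

  ⟦⟧-∘ : ∀ {A Y Y'} {ρ : Pred (A ⊗ A)} {f g : Hom Y A} {h : Hom Y' Y} →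
         reindex h (ρ ⟦ f , g ⟧) ≃ ρ ⟦ f ∘ h , g ∘ h ⟧
  ⟦⟧-∘ = reindex-∘≈ ⟨⟩∘

  reindex-η : ∀ {A Y} {ρ : Pred (A ⊗ A)} {x : Hom Y (A ⊗ A)} → reindex x ρ ≃ ρ ⟦ π₁ ∘ x , π₂ ∘ x ⟧
  reindex-η = re-resp (⟨⟩-unique ≈-refl ≈-refl)

  reindex-id⊗id : ∀ {A} {α : Pred (A ⊗ A)} → reindex (id ⊗₁ id) α ≃ α
  reindex-id⊗id = (proj₂ (re-resp id⊗id) ▸ proj₁ re-id) , (proj₂ re-id ▸ proj₁ (re-resp id⊗id))

  module _ {A : Obj} {ρ : Pred (A ⊗ A)} (ρ-eq : IsEqRel ρ) where
    open IsEqRel ρ-eq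

    ⟦⟧-refl : ∀ {Y} {f : Hom Y A} → ⊤ ≤ ρ ⟦ f , f ⟧
    ⟦⟧-refl {f = f} = proj₂ (re-⊤ f) ▸ re-mono f (∃Δ-unit reflexive) ▸ proj₁ ⟦⟧-∘
                      ▸ ⟦⟧-cong idˡ idˡ

    ⟦⟧-sym : ∀ {Y} {f g : Hom Y A} → ρ ⟦ f , g ⟧ ≤ ρ ⟦ g , f ⟧
    ⟦⟧-sym {f = f} {g} = re-mono ⟨ f , g ⟩ symmetric ▸ proj₁ ⟦⟧-∘ ▸ ⟦⟧-cong π₂-β π₁-β

    ⟦⟧-trans : ∀ {Y} {f g h : Hom Y A} → ρ ⟦ f , g ⟧ ∧ ρ ⟦ g , h ⟧ ≤ ρ ⟦ f , h ⟧
    ⟦⟧-trans {Y} {f} {g} {h} =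
      ∧-glb (∧-lb₁ ▸ ⟦⟧-cong (≈-sym p₁-k) (≈-sym p₂-k) ▸ proj₂ ⟦⟧-∘)
            (∧-lb₂ ▸ ⟦⟧-cong (≈-sym p₂-k) (≈-sym p₃-k) ▸ proj₂ ⟦⟧-∘)
      ▸ proj₂ (re-∧ k) ▸ re-mono k transitive ▸ proj₁ ⟦⟧-∘ ▸ ⟦⟧-cong p₁-k p₃-k
      where
      k : Hom Y ((A ⊗ A) ⊗ A)
      k = ⟨ ⟨ f , g ⟩ , h ⟩
      p₁-k : p₁ ∘ k ≈ f
      p₁-k = assoc ■ ∘-resp ≈-refl π₁-β ■ π₁-β
      p₂-k : p₂ ∘ k ≈ g
      p₂-k = assoc ■ ∘-resp ≈-refl π₁-β ■ π₂-β
      p₃-k : p₃ ∘ k ≈ h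
      p₃-k = π₂-β

  Des-transport : ∀ {A Y} {ρ : Pred (A ⊗ A)} {α : Pred A} → Des ρ α → {f g : Hom Y A} →
                  reindex f α ∧ ρ ⟦ f , g ⟧ ≤ reindex g α
  Des-transport d {f} {g} =
    ∧-glb (∧-lb₁ ▸ proj₂ (reindex-∘≈ π₁-β)) ∧-lb₂ ▸ proj₂ (re-∧ ⟨ f , g ⟩)
    ▸ re-mono ⟨ f , g ⟩ d ▸ proj₁ (reindex-∘≈ π₂-β)

  Des-antitone : ∀ {A} {ρ σ : Pred (A ⊗ A)} {α : Pred A} → σ ≤ ρ → Des ρ α → Des σ α
  Des-antitone σ≤ρ d = ∧-glb ∧-lb₁ (∧-lb₂ ▸ σ≤ρ) ▸ d

  Des-resp : ∀ {A} {ρ : Pred (A ⊗ A)} {α β : Pred A} → α ≃ β → Des ρ α → Des ρ β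
  Des-resp (α≤β , β≤α) d = ∧-glb (∧-lb₁ ▸ re-mono π₁ β≤α) ∧-lb₂ ▸ d ▸ re-mono π₂ α≤β

  ⊠-intro : ∀ {A B Y} {ρ : Pred (A ⊗ A)} {σ : Pred (B ⊗ B)} {f g : Hom Y (A ⊗ B)} →
            ρ ⟦ π₁ ∘ f , π₁ ∘ g ⟧ ∧ σ ⟦ π₂ ∘ f , π₂ ∘ g ⟧ ≤ (ρ ⊠ σ) ⟦ f , g ⟧
  ⊠-intro = ∧-glb (∧-lb₁ ▸ proj₂ (reindex-∘≈ ⊗∘⟨⟩)) (∧-lb₂ ▸ proj₂ (reindex-∘≈ ⊗∘⟨⟩))
            ▸ proj₂ (re-∧ _)

  eqRel-Des-⊠ : ∀ {A} {ρ : Pred (A ⊗ A)} → IsEqRel ρ → Des (ρ ⊠ ρ) ρ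
  eqRel-Des-⊠ ρ-eq =
    ∧-glb (∧-glb (∧-lb₂ ▸ ∧-lb₁ ▸ ⟦⟧-sym ρ-eq) (∧-lb₁ ▸ proj₁ reindex-η)) (∧-lb₂ ▸ ∧-lb₂)
    ▸ ∧-glb (∧-lb₁ ▸ ⟦⟧-trans ρ-eq) ∧-lb₂
    ▸ ⟦⟧-trans ρ-eq ▸ proj₂ reindex-η

  QEq-pointwise : ∀ {X W} (f g : QHom X W) → QEq f g → ∀ {Y} (x : Hom Y (car X)) →
                  ⊤ ≤ rel W ⟦ fun f ∘ x , fun g ∘ x ⟧
  QEq-pointwise {X} f g f≈g x =
    ⟦⟧-refl (isEq X) ▸ re-mono ⟨ x , x ⟩ f≈g ▸ proj₁ ⟦⟧-∘
    ▸ ⟦⟧-cong (assoc ■ ∘-resp ≈-refl π₁-β) (assoc ■ ∘-resp ≈-refl π₂-β)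

module QuotientsInCompletion {o m e p l : Level}
    (C : CartOps o m e) (isC : IsCartesian C)
    (P : DocOps C p l) (isP : IsPrimary C P)
    (E : Notions.Elementary C P)
    (Ē : Notions.Elementary (Completion.Q C isC P isP E) (Completion.P̄ C isC P isP E)) where
  open CartOps C
  open IsCartesian isC
  open DocOps P
  open IsPrimary isP
  open Notions.WithElementary C P E using (IsEqRel)
  open Completion C isC P isP E
  open Relations C isC P isP E
  module Q = CartOps Q
  module Ē = Notions.Elementary Ē
  module P̄ᴱ = Notions.WithElementary Q P̄ Ē

  δ̄ : (X : QObj) → Pred (car X ⊗ car X)
  δ̄ X = proj₁ (P̄ᴱ.δ X)

  δ̄≤rel : (X : QObj) → δ̄ X ≤ rel X
  δ̄≤rel X = Ē.∃Δ-counit {β = rel X , eqRel-Des-⊠ (isEq X)} (⟦⟧-refl (isEq X))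

  rel≤δ̄ : (X : QObj) → rel X ≤ δ̄ X
  rel≤δ̄ X =
    ∧-glb (⊤-max ▸ δ̄-on-diagonal) (∧-glb (⊤-max ▸ r-refl) r-self ▸ ⊠-intro)
    ▸ Des-transport (proj₂ (P̄ᴱ.δ X)) ▸ proj₁ re-id
    where
    δ̄-on-diagonal : ⊤ ≤ reindex ⟨ π₁ , π₁ ⟩ (δ̄ X)
    δ̄-on-diagonal =
      proj₂ (re-⊤ π₁) ▸ re-mono π₁ (Ē.∃Δ-unit {X} {β = P̄ᴱ.δ X} ≤-refl)
      ▸ proj₁ (reindex-∘≈ (⟨⟩∘ ■ ⟨⟩-cong idˡ idˡ))
    r-refl : ⊤ ≤ rel X ⟦ π₁ ∘ ⟨ π₁ , π₁ ⟩ , π₁ ∘ id ⟧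
    r-refl = ⟦⟧-refl (isEq X) ▸ ⟦⟧-cong (≈-sym π₁-β) (≈-sym idʳ)
    r-self : rel X ≤ rel X ⟦ π₂ ∘ ⟨ π₁ , π₁ ⟩ , π₂ ∘ id ⟧
    r-self = proj₂ re-id ▸ proj₁ reindex-η ▸ ⟦⟧-cong (idʳ ■ ≈-sym π₂-β) ≈-refl

  module _ (X : QObj) (ρ : DocOps.Pred P̄ (X Q.⊗ X)) (ρ-eq : P̄ᴱ.IsEqRel {X} ρ) where
    open P̄ᴱ.IsEqRel ρ-eq

    rel≤ρ : rel X ≤ proj₁ ρ
    rel≤ρ = rel≤δ̄ X ▸ reflexive

    ρ-isEqRel : IsEqRel (proj₁ ρ)
    ρ-isEqRel = record
      { reflexive  = IsEqRel.reflexive (isEq X) ▸ rel≤ρ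
      ; symmetric  = symmetric
      ; transitive = transitive
      }

    X/ρ : QObj
    X/ρ = qobj (car X) (proj₁ ρ) ρ-isEqRel

    [id] : QHom X X/ρ
    [id] = qhom id (rel≤ρ ▸ proj₂ reindex-id⊗id)

    [id]-effective : P̄ᴱ.IsEffective ρ [id]
    [id]-effective = (proj₁ reindex-id⊗id ▸ δ̄≤rel X/ρ) , (rel≤δ̄ X/ρ ▸ proj₂ reindex-id⊗id)

    [id]-universal : ∀ {W} (g : QHom X W) → proj₁ ρ ≤ reindex (fun g ⊗₁ fun g) (δ̄ W) →
                     Σ (QHom X/ρ W) λ h → (h Q.∘ [id] Q.≈ g) ×
                       (∀ (h' : QHom X/ρ W) → h' Q.∘ [id] Q.≈ g → h' Q.≈ h)
    [id]-universal {W} g g-resp = g̃ , g∘id≈g , unique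
      where
      g̃ : QHom X/ρ W
      g̃ = qhom (fun g) (g-resp ▸ re-mono _ (δ̄≤rel W))
      g∘id≈g : rel X ≤ reindex ((fun g ∘ id) ⊗₁ fun g) (rel W)
      g∘id≈g = pres g ▸ ⟦⟧-cong (∘-resp (≈-sym idʳ) ≈-refl) ≈-refl
      unique : ∀ (h' : QHom X/ρ W) → h' Q.∘ [id] Q.≈ g → h' Q.≈ g̃
      unique h' h'∘id≈g =
        ∧-glb (pres h')
              (⊤-max ▸ QEq-pointwise (h' Q.∘ [id]) g h'∘id≈g π₂
                ▸ ⟦⟧-cong (assoc ■ ∘-resp ≈-refl idˡ) ≈-refl)
        ▸ ⟦⟧-trans (isEq W)

    [id]-quotient : P̄ᴱ.IsQuotient ρ [id]
    [id]-quotient = proj₂ [id]-effective , [id]-universal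

    [id]-effectiveDescent : P̄ᴱ.IsEffectiveDescent [id]
    [id]-effectiveDescent = record
      { into      = λ α → Des-resp (proj₂ re-id , proj₁ re-id)
                                   (Des-antitone (proj₁ [id]-effective) (proj₂ α))
      ; inv       = λ β d → proj₁ β , Des-antitone (proj₂ [id]-effective) d
      ; inv-mono  = λ _ _ β≤β' → β≤β'
      ; inv-left  = λ _ → re-id
      ; inv-right = λ _ _ → re-id
      }

-- The weak comprehensions wc are what make P̄ elementary; that structure is supplied
-- as Ē, and the argument itself never uses wc.
lemma5p4 : ∀ {o m e p l : Level}
    (C : CartOps o m e) (isC : IsCartesian C)
    (P : DocOps C p l) (isP : IsPrimary C P)
    (E : Notions.Elementary C P)
    (wc : ∀ {A} (α : DocOps.Pred P A) → Notions.WeakComprehension C P α)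
    (Ē : Notions.Elementary (Completion.Q C isC P isP E) (Completion.P̄ C isC P isP E)) →
    let Q  = Completion.Q C isC P isP E
        P̄ = Completion.P̄ C isC P isP E
        open CartOps Q
        open DocOps P̄
        open Notions.WithElementary Q P̄ Ē
    in ∀ (X : Obj) (ρ : Pred (X ⊗ X)) → IsEqRel {X} ρ →
       Σ Obj λ Z → Σ (Hom X Z) λ q →
         IsQuotient ρ q × IsEffective ρ q × IsEffectiveDescent q
lemma5p4 C isC P isP E _ Ē X ρ ρ-eq =
  X/ρ X ρ ρ-eq , [id] X ρ ρ-eq ,
  [id]-quotient X ρ ρ-eq , [id]-effective X ρ ρ-eq , [id]-effectiveDescent X ρ ρ-eq
  where open QuotientsInCompletion C isC P isP E Ē
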